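{- Let $p$ be an odd prime and assume that $|\mathcal{L}_{\lambda}(p^k)| = p^k - 1$ for some integer $k \geq 1$. Then $\lambda(n) = \chi_p(n)$ for all integers $1 \leq n < p^k$ with $p \nmid n$.
   Context: $\lambda$ is the Liouville function, $\lambda(n)=(-1)^{\Omega(n)}$ with $\Omega(n)$ the number of prime factors of $n$ counted with multiplicity. For an integer $N \geq 1$, $\mathcal{L}_{\lambda}(N) := \sum_{1 \leq n < N} \lambda(n)\lambda(N-n)$. $\chi_p = \left(\frac{\cdot}{p}\right)$ is the Legendre symbol modulo the odd prime $p$. -}

module Defs where

open import Data.Nat using (ℕ; zero; suc; _+_; _*_; _∸_; _^_; _<_; NonZero; _%_)
open import Data.Nat.Divisibility using (_∣_; _∣?_)
open import Data.Nat.Primality.Factorisation using (PrimeFactorisation; factorise)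
open import Data.Integer as ℤ using (ℤ; +_; -_)
open import Data.List using (List; length; map; sum; upTo)
open import Data.List.Relation.Unary.Any using (any?)
open import Relation.Binary.PropositionalEquality using (_≡_)
open import Relation.Nullary using (Dec; yes; no; ¬_)
open import Relation.Nullary.Decidable using (⌊_⌋)
import Data.Nat as ℕ

Ω : (n : ℕ) → .{{NonZero n}} → ℕ
Ω n = length (PrimeFactorisation.factors (factorise n))

neg1^ : ℕ → ℤ
neg1^ zero = + 1
neg1^ (suc m) = - neg1^ m

liouville : (n : ℕ) → .{{NonZero n}} → ℤ
liouville n = neg1^ (Ω n)

-- λ on all of ℕ; value at 0 is irrelevant (never used with n = 0 below), set to 0.
liouville₀ : ℕ → ℤ
liouville₀ zero = + 0
liouville₀ (suc n) = liouville (suc n)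

Σ₁ : ℕ → (ℕ → ℤ) → ℤ
Σ₁ zero f = + 0
Σ₁ (suc m) f = Σ₁ m f ℤ.+ f (suc m)

-- 𝓛_λ(N) = Σ_{1 ≤ n < N} λ(n) λ(N - n)  (for 1 ≤ n ≤ N - 1 both arguments are ≥ 1,
-- so the value of liouville₀ at 0 is never used).
Lλ : ℕ → ℤ
Lλ N = Σ₁ (N ∸ 1) (λ n → liouville₀ n ℤ.* liouville₀ (N ∸ n))

legendre : (p : ℕ) → .{{NonZero p}} → ℕ → ℤ
legendre p n with p ∣? n
... | yes _ = + 0
... | no _ with any? (λ x → ((x * x) % p) ℕ.≟ (n % p)) (upTo p)
...   | yes _ = + 1
...   | no _ = - (+ 1)

-- If |𝓛_λ(N)| = N − 1 for N = p^k, every term λ(n) λ(N − n) of the sum equals one sign ε, so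
-- λ(N − n) = ε λ(n). With complete multiplicativity this makes λ multiplicative modulo N:
-- λ(ab mod N) = λ(a) λ(b) whenever N ∤ ab, by induction on (a, b) via N = q b + r. So λ is 1 on
-- squares modulo N prime to p and, by Hensel lifting, on every quadratic residue mod p below N.
-- As λ(2) = −1, 2 is a non-residue; then for a non-residue n, 2n is a residue (the squares and
-- twice the squares of 0, …, (p − 1)/2 exhaust the residues), whence λ(n) = −λ(2n mod N) = −1.
module Submission where

open import Defs
open import Data.Nat using (ℕ; suc; _^_; _∸_; _≤_; _<_; NonZero)
open import Data.Nat.Primality using (Prime)
open import Data.Nat.Divisibility using (_∣_)
open import Data.Integer using (∣_∣)
open import Relation.Nullary using (¬_)
open import Relation.Binary.PropositionalEquality using (_≡_)

import Algebra.Properties.CommutativeSemigroup as CommutativeSemigroupProperties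
open import Data.Fin using (Fin; toℕ; fromℕ<; punchOut)
import Data.Fin.Properties as FinP
open import Data.Integer as ℤ using (ℤ; +_; -_; -[1+_]; 1ℤ; -1ℤ)
import Data.Integer.Properties as ℤP
open import Data.Integer.Tactic.RingSolver using (solve-∀)
open import Data.List using (_++_; upTo)
open import Data.List.Membership.Propositional using (lose)
open import Data.List.Membership.Propositional.Properties using (∈-upTo⁺)
open import Data.List.Properties using (length-++)
open import Data.List.Relation.Binary.Permutation.Propositional.Properties using (↭-length)
open import Data.List.Relation.Unary.All.Properties using (++⁺)
open import Data.List.Relation.Unary.Any as Any using (any?)
open import Data.Nat as ℕ using (zero; _+_; _*_; _%_; _/_; z≤n; s≤s)
open import Data.Nat.Coprimality using (Coprime; coprime-Bézout)
open import Data.Nat.DivMod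
  using (m≡m%n+[m/n]*n; m%n%n≡m%n; m∣n⇒o%n%m≡o%m; [m+kn]%n≡m%n; %-distribˡ-+; %-distribˡ-*;
         %-pred-≡0; m%n<n; m<n⇒m%n≡m; m*n%n≡0; n%n≡0)
open import Data.Nat.Divisibility
  using (divides; quotient; _∣?_; _∣0; 1∣_; ∣-refl; ∣-antisym; ∣⇒≤; >⇒∤; m∣m*n; ∣m⇒∣m*n; ∣n⇒∣m*n;
         m*n∣⇒m∣; *-monoʳ-∣; *-cancelˡ-∣; quotient-∣; m∣n⇒n≡m*quotient; ∣n∣m%n⇒∣m;
         m%n≡0⇒n∣m; n∣m⇒m%n≡0)
open import Data.Nat.GCD using (module Bézout)
open import Data.Nat.Induction using (<-rec)
open import Data.Nat.ListAction.Properties using (product-++)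
open import Data.Nat.Primality
  using (Composite; composite; composite?; prime; ¬prime[1]; euclidsLemma;
         prime⇒nonZero; prime⇒nonTrivial; prime⇒irreducible)
open import Data.Nat.Primality.Factorisation using (PrimeFactorisation; factorise; factorisationUnique)
import Data.Nat.Properties as ℕP
import Data.Nat.Tactic.RingSolver as ℕ-Ring
open import Data.Product using (∃; _×_; _,_; proj₁; proj₂)
open import Data.Sum using (_⊎_; inj₁; inj₂; [_,_]′)
open import Function using (_∘_; id; flip; case_of_)
open import Relation.Binary.PropositionalEquality
  using (_≢_; refl; sym; trans; cong; cong₂; subst; module ≡-Reasoning)
open import Relation.Nullary using (Dec; yes; no; contradiction)
import Relation.Nullary.Decidable as Dec

open CommutativeSemigroupProperties ℤP.*-commutativeSemigroup using (x∙yz≈y∙xz; x∙yz≈xz∙y)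
module ℕ* = CommutativeSemigroupProperties ℕP.*-commutativeSemigroup

IsSign : ℤ → Set
IsSign x = x ≡ 1ℤ ⊎ x ≡ -1ℤ

sign-neg : ∀ {x} → IsSign x → IsSign (- x)
sign-neg (inj₁ refl) = inj₂ refl
sign-neg (inj₂ refl) = inj₁ refl

sign-* : ∀ {x y} → IsSign x → IsSign y → IsSign (x ℤ.* y)
sign-* (inj₁ refl) y = subst IsSign (sym (ℤP.*-identityˡ _)) y
sign-* (inj₂ refl) y = subst IsSign (sym (ℤP.-1*i≡-i _)) (sign-neg y)

sign-square : ∀ {x} → IsSign x → x ℤ.* x ≡ 1ℤ
sign-square (inj₁ refl) = refl
sign-square (inj₂ refl) = refl

sign≤1 : ∀ {x} → IsSign x → x ℤ.≤ 1ℤ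
sign≤1 (inj₁ refl) = ℤP.≤-refl
sign≤1 (inj₂ refl) = ℤ.-≤+

square≡1⇒*-cancelˡ : ∀ x {y z} → x ℤ.* x ≡ 1ℤ → x ℤ.* y ≡ x ℤ.* z → y ≡ z
square≡1⇒*-cancelˡ x {y} {z} x²≡1 xy≡xz = begin
  y               ≡⟨ sym (ℤP.*-identityˡ y) ⟩
  1ℤ ℤ.* y        ≡⟨ cong (ℤ._* y) (sym x²≡1) ⟩
  x ℤ.* x ℤ.* y   ≡⟨ ℤP.*-assoc x x y ⟩
  x ℤ.* (x ℤ.* y) ≡⟨ cong (x ℤ.*_) xy≡xz ⟩
  x ℤ.* (x ℤ.* z) ≡⟨ sym (ℤP.*-assoc x x z) ⟩
  x ℤ.* x ℤ.* z   ≡⟨ cong (ℤ._* z) x²≡1 ⟩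
  1ℤ ℤ.* z        ≡⟨ ℤP.*-identityˡ z ⟩
  z               ∎
  where open ≡-Reasoning

neg1^-+ : ∀ a b → neg1^ (a + b) ≡ neg1^ a ℤ.* neg1^ b
neg1^-+ zero    b = sym (ℤP.*-identityˡ (neg1^ b))
neg1^-+ (suc a) b = trans (cong -_ (neg1^-+ a b)) (ℤP.neg-distribˡ-* (neg1^ a) (neg1^ b))

neg1^-sign : ∀ a → IsSign (neg1^ a)
neg1^-sign zero    = inj₁ refl
neg1^-sign (suc a) = sign-neg (neg1^-sign a)

Ω-* : ∀ m n .{{_ : NonZero m}} .{{_ : NonZero n}} .{{_ : NonZero (m * n)}} →
      Ω (m * n) ≡ Ω m + Ω n
Ω-* m n = trans (↭-length (factorisationUnique (factorise (m * n)) m*n-factorisation))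
                (length-++ (factors fm))
  where
  open PrimeFactorisation
  fm : PrimeFactorisation m
  fm = factorise m
  fn : PrimeFactorisation n
  fn = factorise n
  m*n-factorisation : PrimeFactorisation (m * n)
  m*n-factorisation = record
    { factors         = factors fm ++ factors fn
    ; isFactorisation = trans (cong₂ _*_ (isFactorisation fm) (isFactorisation fn))
                              (sym (product-++ (factors fm) (factors fn)))
    ; factorsPrime    = ++⁺ (factorsPrime fm) (factorsPrime fn)
    }

liouville₀-* : ∀ m n → liouville₀ (m * n) ≡ liouville₀ m ℤ.* liouville₀ n
liouville₀-* zero    n       = refl
liouville₀-* (suc m) zero    =
  trans (cong liouville₀ (ℕP.*-zeroʳ m)) (sym (ℤP.*-zeroʳ (liouville₀ (suc m))))
liouville₀-* (suc m) (suc n) =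
  trans (cong neg1^ (Ω-* (suc m) (suc n))) (neg1^-+ (Ω (suc m)) (Ω (suc n)))

liouville₀-sign : ∀ {n} → 1 ≤ n → IsSign (liouville₀ n)
liouville₀-sign {suc n} _ = neg1^-sign (Ω (suc n))

liouville≡liouville₀ : ∀ n .{{_ : NonZero n}} → liouville n ≡ liouville₀ n
liouville≡liouville₀ (suc n) = refl

sum≡⇒summands≡ : ∀ {i j k l} → i ℤ.≤ j → k ℤ.≤ l → i ℤ.+ k ≡ j ℤ.+ l → i ≡ j × k ≡ l
sum≡⇒summands≡ i≤j k≤l sum≡ =
    ℤP.≤-antisym i≤j (ℤP.≮⇒≥ λ i<j → ℤP.<-irrefl sum≡ (ℤP.+-mono-<-≤ i<j k≤l))
  , ℤP.≤-antisym k≤l (ℤP.≮⇒≥ λ k<l → ℤP.<-irrefl sum≡ (ℤP.+-mono-≤-< i≤j k<l))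

Σ₁-≤ : ∀ m g → (∀ {n} → 1 ≤ n → n ≤ m → g n ℤ.≤ 1ℤ) → Σ₁ m g ℤ.≤ + m
Σ₁-≤ zero    g g≤1 = ℤP.≤-refl
Σ₁-≤ (suc m) g g≤1 = begin
  Σ₁ m g ℤ.+ g (suc m) ≤⟨ ℤP.+-mono-≤ (Σ₁-≤ m g (λ 1≤n → g≤1 1≤n ∘ ℕP.m≤n⇒m≤1+n))
                                     (g≤1 (s≤s z≤n) ℕP.≤-refl) ⟩
  + m ℤ.+ 1ℤ           ≡⟨ ℤP.+-comm (+ m) 1ℤ ⟩
  + suc m              ∎
  where open ℤP.≤-Reasoning

Σ₁≡m⇒≡1 : ∀ m g → (∀ {n} → 1 ≤ n → n ≤ m → g n ℤ.≤ 1ℤ) → Σ₁ m g ≡ + m →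
          ∀ {n} → 1 ≤ n → n ≤ m → g n ≡ 1ℤ
Σ₁≡m⇒≡1 zero    g g≤1 Σ≡m 1≤n n≤0 = contradiction (ℕP.≤-trans 1≤n n≤0) λ ()
Σ₁≡m⇒≡1 (suc m) g g≤1 Σ≡m 1≤n n≤1+m =
  [ (λ n<1+m → Σ₁≡m⇒≡1 m g g≤1′ (proj₁ summands) 1≤n (ℕP.≤-pred n<1+m))
  , (λ { refl → proj₂ summands })
  ]′ (ℕP.m≤n⇒m<n∨m≡n n≤1+m)
  where
  g≤1′ : ∀ {n} → 1 ≤ n → n ≤ m → g n ℤ.≤ 1ℤ
  g≤1′ 1≤n = g≤1 1≤n ∘ ℕP.m≤n⇒m≤1+n
  summands : Σ₁ m g ≡ + m × g (suc m) ≡ 1ℤ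
  summands = sum≡⇒summands≡ (Σ₁-≤ m g g≤1′) (g≤1 (s≤s z≤n) ℕP.≤-refl)
                            (trans Σ≡m (ℤP.+-comm 1ℤ (+ m)))

Σ₁-neg : ∀ m g → Σ₁ m (λ n → - g n) ≡ - Σ₁ m g
Σ₁-neg zero    g = refl
Σ₁-neg (suc m) g = trans (cong (ℤ._+ - g (suc m)) (Σ₁-neg m g))
                         (sym (ℤP.neg-distrib-+ (Σ₁ m g) (g (suc m))))

Σ₁-signs-constant : ∀ m g → (∀ {n} → 1 ≤ n → n ≤ m → IsSign (g n)) → ∣ Σ₁ m g ∣ ≡ m →
                    ∃ λ ε → IsSign ε × (∀ {n} → 1 ≤ n → n ≤ m → g n ≡ ε)
Σ₁-signs-constant m g signs ∣Σ∣≡m with Σ₁ m g in Σ≡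
... | + _      = 1ℤ , inj₁ refl ,
  Σ₁≡m⇒≡1 m g (λ 1≤n n≤m → sign≤1 (signs 1≤n n≤m)) (trans Σ≡ (cong +_ ∣Σ∣≡m))
... | -[1+ _ ] = -1ℤ , inj₂ refl , λ 1≤n n≤m → ℤP.neg-injective
  (Σ₁≡m⇒≡1 m (-_ ∘ g) (λ 1≤n n≤m → sign≤1 (sign-neg (signs 1≤n n≤m)))
           (trans (Σ₁-neg m g) (trans (cong -_ Σ≡) (cong +_ ∣Σ∣≡m))) 1≤n n≤m)

liouville-reflection : ∀ N → ∣ Lλ N ∣ ≡ N ∸ 1 →
  ∃ λ ε → IsSign ε × (∀ {n} → 1 ≤ n → n < N → liouville₀ (N ∸ n) ≡ ε ℤ.* liouville₀ n)
liouville-reflection zero    _     = 1ℤ , inj₁ refl , λ _ ()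
liouville-reflection (suc N) ∣L∣≡N = ε , proj₁ (proj₂ constancy) , reflect
  where
  summand : ℕ → ℤ
  summand n = liouville₀ n ℤ.* liouville₀ (suc N ∸ n)
  summand-sign : ∀ {n} → 1 ≤ n → n ≤ N → IsSign (summand n)
  summand-sign 1≤n n≤N =
    sign-* (liouville₀-sign 1≤n) (liouville₀-sign (ℕP.m<n⇒0<n∸m (s≤s n≤N)))
  constancy : ∃ λ ε → IsSign ε × (∀ {n} → 1 ≤ n → n ≤ N → summand n ≡ ε)
  constancy = Σ₁-signs-constant N summand summand-sign ∣L∣≡N
  ε : ℤ
  ε = proj₁ constancy
  reflect : ∀ {n} → 1 ≤ n → n < suc N → liouville₀ (suc N ∸ n) ≡ ε ℤ.* liouville₀ n
  reflect {n} 1≤n n<1+N = square≡1⇒*-cancelˡ fₙ fₙ²≡1 (begin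
    fₙ ℤ.* liouville₀ (suc N ∸ n) ≡⟨ proj₂ (proj₂ constancy) 1≤n (ℕP.≤-pred n<1+N) ⟩
    ε                             ≡⟨ sym (ℤP.*-identityʳ ε) ⟩
    ε ℤ.* 1ℤ                      ≡⟨ cong (ε ℤ.*_) (sym fₙ²≡1) ⟩
    ε ℤ.* (fₙ ℤ.* fₙ)             ≡⟨ x∙yz≈y∙xz ε fₙ fₙ ⟩
    fₙ ℤ.* (ε ℤ.* fₙ)             ∎)
    where
    open ≡-Reasoning
    fₙ : ℤ
    fₙ = liouville₀ n
    fₙ²≡1 : fₙ ℤ.* fₙ ≡ 1ℤ
    fₙ²≡1 = sign-square (liouville₀-sign 1≤n)

p^k∣m*n⇒p^k∣n : ∀ {p m} → Prime p → ¬ p ∣ m → ∀ k {n} → p ^ k ∣ m * n → p ^ k ∣ n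
p^k∣m*n⇒p^k∣n         _       _   zero    _        = 1∣ _
p^k∣m*n⇒p^k∣n {p} {m} p-prime p∤m (suc k) {n} p^[1+k]∣m*n
  with euclidsLemma m n p-prime (m*n∣⇒m∣ p (p ^ k) p^[1+k]∣m*n)
... | inj₁ p∣m = contradiction p∣m p∤m
... | inj₂ (divides n′ refl) = subst (p ^ suc k ∣_) (ℕP.*-comm p n′) (*-monoʳ-∣ p p^k∣n′)
  where
  instance
    p≢0 : NonZero p
    p≢0 = prime⇒nonZero p-prime
  p^k∣n′ : p ^ k ∣ n′
  p^k∣n′ = p^k∣m*n⇒p^k∣n p-prime p∤m k
    (*-cancelˡ-∣ p (subst (p ^ suc k ∣_) (ℕ*.x∙yz≈z∙xy m n′ p) p^[1+k]∣m*n))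

∣p^k∧≢1⇒p∣ : ∀ {p d} → Prime p → ∀ k → d ∣ p ^ k → d ≢ 1 → p ∣ d
∣p^k∧≢1⇒p∣ {p} {d} p-prime k d∣p^k@(divides e p^k≡e*d) d≢1 with p ∣? d
... | yes p∣d = p∣d
... | no  p∤d = contradiction (ℕP.*-cancelˡ-≡ d 1 (p ^ k) p^k*d≡p^k*1) d≢1
  where
  instance
    p^k≢0 : NonZero (p ^ k)
    p^k≢0 = ℕP.m^n≢0 p k {{prime⇒nonZero p-prime}}
  e≡p^k : e ≡ p ^ k
  e≡p^k = ∣-antisym (quotient-∣ d∣p^k) (p^k∣m*n⇒p^k∣n p-prime p∤d k
    (divides 1 (trans (ℕP.*-comm d e) (trans (sym p^k≡e*d) (sym (ℕP.*-identityˡ _))))))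
  p^k*d≡p^k*1 : p ^ k * d ≡ p ^ k * 1
  p^k*d≡p^k*1 =
    trans (cong (_* d) (sym e≡p^k)) (trans (sym p^k≡e*d) (sym (ℕP.*-identityʳ _)))

d∣p^k∧d<p^k⇒p*d≤p^k : ∀ {p d} → Prime p → ∀ k → d ∣ p ^ k → d < p ^ k → p * d ≤ p ^ k
d∣p^k∧d<p^k⇒p*d≤p^k {p} {d} p-prime k d∣p^k@(divides e p^k≡e*d) d<p^k = begin
  p * d ≤⟨ ℕP.*-monoˡ-≤ d (∣⇒≤ {{e≢0}} (∣p^k∧≢1⇒p∣ p-prime k (quotient-∣ d∣p^k) e≢1)) ⟩
  e * d ≡⟨ p^k≡e*d ⟨
  p ^ k ∎
  where
  open ℕP.≤-Reasoning
  e≢1 : e ≢ 1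
  e≢1 refl = ℕP.<-irrefl (sym (trans p^k≡e*d (ℕP.+-identityʳ d))) d<p^k
  e≢0 : NonZero e
  e≢0 = ℕP.m*n≢0⇒m≢0 e {{subst NonZero p^k≡e*d (ℕP.m^n≢0 p k {{prime⇒nonZero p-prime}})}}

m*[n%d]%d≡m*n%d : ∀ m n d .{{_ : NonZero d}} → (m * (n % d)) % d ≡ (m * n) % d
m*[n%d]%d≡m*n%d m n d = begin
  (m * (n % d)) % d           ≡⟨ %-distribˡ-* m (n % d) d ⟩
  ((m % d) * (n % d % d)) % d ≡⟨ cong (λ x → ((m % d) * x) % d) (m%n%n≡m%n n d) ⟩
  ((m % d) * (n % d)) % d     ≡⟨ %-distribˡ-* m n d ⟨
  (m * n) % d                 ∎
  where open ≡-Reasoning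

[m%d]*n%d≡m*n%d : ∀ m n d .{{_ : NonZero d}} → ((m % d) * n) % d ≡ (m * n) % d
[m%d]*n%d≡m*n%d m n d = begin
  ((m % d) * n) % d ≡⟨ cong (_% d) (ℕP.*-comm (m % d) n) ⟩
  (n * (m % d)) % d ≡⟨ m*[n%d]%d≡m*n%d n m d ⟩
  (n * m) % d       ≡⟨ cong (_% d) (ℕP.*-comm n m) ⟩
  (m * n) % d       ∎
  where open ≡-Reasoning

[n∸1]*[n∸1]%n≡1 : ∀ n .{{_ : NonZero n}} → 1 < n → ((n ∸ 1) * (n ∸ 1)) % n ≡ 1
[n∸1]*[n∸1]%n≡1 (suc zero)    (s≤s ())
[n∸1]*[n∸1]%n≡1 (suc (suc r)) _ =
  trans (cong (_% suc (suc r)) (square r)) ([m+kn]%n≡m%n 1 r (suc (suc r)))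
  where
  square : ∀ r → suc r * suc r ≡ 1 + r * suc (suc r)
  square = ℕ-Ring.solve-∀

n%d≡0⇒[m*n]%d≡0 : ∀ m n d .{{_ : NonZero d}} → n % d ≡ 0 → (m * n) % d ≡ 0
n%d≡0⇒[m*n]%d≡0 m n d n%d≡0 = n∣m⇒m%n≡0 (m * n) d (∣n⇒∣m*n m (m%n≡0⇒n∣m n d n%d≡0))

-- m % d + n % d is a multiple of d strictly between 0 and 2 d.
[m+n]%d≡0⇒m%d≡d∸n%d : ∀ m n d .{{_ : NonZero d}} → (m + n) % d ≡ 0 → n % d ≢ 0 →
                      m % d ≡ d ∸ n % d
[m+n]%d≡0⇒m%d≡d∸n%d m n d [m+n]%d≡0 n%d≢0
  with m%n≡0⇒n∣m (m % d + n % d) d (trans (sym (%-distribˡ-+ m n d)) [m+n]%d≡0)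
... | divides zero          s≡0 = contradiction (ℕP.m+n≡0⇒n≡0 (m % d) s≡0) n%d≢0
... | divides 1             s≡d =
  trans (sym (ℕP.m+n∸n≡m (m % d) (n % d))) (cong (_∸ n % d) (trans s≡d (ℕP.+-identityʳ d)))
... | divides (suc (suc q)) s≡ = contradiction
  (ℕP.+-mono-< (m%n<n m d) (m%n<n n d))
  (ℕP.≤⇒≯ (subst (d + d ≤_) (sym s≡) (ℕP.+-monoʳ-≤ d (ℕP.m≤m+n d (q * d)))))

module ModularMultiplicativity
  {p : ℕ} (p-prime : Prime p) (k : ℕ) (f : ℕ → ℤ)
  (f-* : ∀ m n → f (m * n) ≡ f m ℤ.* f n)
  (f-square : ∀ {n} → 1 ≤ n → f n ℤ.* f n ≡ 1ℤ)
  (ε : ℤ) (ε-square : ε ℤ.* ε ≡ 1ℤ)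
  (f-reflect : ∀ {n} → 1 ≤ n → n < p ^ k → f (p ^ k ∸ n) ≡ ε ℤ.* f n)
  where

  N : ℕ
  N = p ^ k

  instance
    N≢0 : NonZero N
    N≢0 = ℕP.m^n≢0 p k {{prime⇒nonZero p-prime}}

  MultiplicativeAt : ℕ → ℕ → Set
  MultiplicativeAt a b = (a * b) % N ≢ 0 → f ((a * b) % N) ≡ f a ℤ.* f b

  mult-direct : ∀ {a b} → a * b < N → MultiplicativeAt a b
  mult-direct {a} {b} ab<N _ = trans (cong f (m<n⇒m%n≡m ab<N)) (f-* a b)

  mult-comm : ∀ {a b} → MultiplicativeAt a b → MultiplicativeAt b a
  mult-comm {a} {b} a·b = subst (λ x → x % N ≢ 0 → f (x % N) ≡ f b ℤ.* f a) (ℕP.*-comm a b)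
    (λ c≢0 → trans (a·b c≢0) (ℤP.*-comm (f a) (f b)))

  mult-reflect : ∀ {a b} → b < N → MultiplicativeAt a (N ∸ b) → MultiplicativeAt a b
  mult-reflect {a} {b} b<N a·[N-b] c≢0 = square≡1⇒*-cancelˡ ε ε-square (begin
    ε ℤ.* f c           ≡⟨ f-reflect (ℕP.n≢0⇒n>0 c≢0) (m%n<n (a * b) N) ⟨
    f (N ∸ c)           ≡⟨ cong f X%N≡N∸c ⟨
    f (X % N)           ≡⟨ a·[N-b] (ℕP.m>n⇒m∸n≢0 (m%n<n (a * b) N) ∘ trans (sym X%N≡N∸c)) ⟩
    f a ℤ.* f (N ∸ b)   ≡⟨ cong (f a ℤ.*_) (f-reflect (ℕP.n≢0⇒n>0 b≢0) b<N) ⟩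
    f a ℤ.* (ε ℤ.* f b) ≡⟨ x∙yz≈y∙xz (f a) ε (f b) ⟩
    ε ℤ.* (f a ℤ.* f b) ∎)
    where
    open ≡-Reasoning
    c X : ℕ
    c = (a * b) % N
    X = a * (N ∸ b)
    X%N≡N∸c : X % N ≡ N ∸ c
    X%N≡N∸c = [m+n]%d≡0⇒m%d≡d∸n%d X (a * b) N (begin
      (X + a * b) % N       ≡⟨ cong (_% N) (ℕP.*-distribˡ-+ a (N ∸ b) b) ⟨
      (a * (N ∸ b + b)) % N ≡⟨ cong (λ x → (a * x) % N) (ℕP.m∸n+n≡m (ℕP.<⇒≤ b<N)) ⟩
      (a * N) % N           ≡⟨ m*n%n≡0 a N ⟩
      0                     ∎) c≢0
    b≢0 : b ≢ 0
    b≢0 refl = c≢0 (n%d≡0⇒[m*n]%d≡0 a 0 N (n∣m⇒m%n≡0 0 N (N ∣0)))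

  mult-*ˡ : ∀ {u v b} → MultiplicativeAt v b → MultiplicativeAt u ((v * b) % N) →
            MultiplicativeAt (u * v) b
  mult-*ˡ {u} {v} {b} v·b u·[vb] uvb≢0 = begin
    f ((u * v * b) % N)         ≡⟨ cong f reassoc ⟨
    f ((u * ((v * b) % N)) % N) ≡⟨ u·[vb] (uvb≢0 ∘ trans (sym reassoc)) ⟩
    f u ℤ.* f ((v * b) % N)     ≡⟨ cong (f u ℤ.*_) (v·b vb≢0) ⟩
    f u ℤ.* (f v ℤ.* f b)       ≡⟨ ℤP.*-assoc (f u) (f v) (f b) ⟨
    f u ℤ.* f v ℤ.* f b         ≡⟨ cong (ℤ._* f b) (f-* u v) ⟨
    f (u * v) ℤ.* f b           ∎
    where
    open ≡-Reasoning
    reassoc : (u * ((v * b) % N)) % N ≡ (u * v * b) % N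
    reassoc = trans (m*[n%d]%d≡m*n%d u (v * b) N) (cong (_% N) (sym (ℕP.*-assoc u v b)))
    vb≢0 : (v * b) % N ≢ 0
    vb≢0 = uvb≢0 ∘ trans (cong (_% N) (ℕP.*-assoc u v b)) ∘ n%d≡0⇒[m*n]%d≡0 u (v * b) N

  mult-via : ∀ {a b j} → 1 ≤ j → (j * (a * b)) % N ≢ 0 → MultiplicativeAt j b →
             MultiplicativeAt a ((j * b) % N) → MultiplicativeAt j ((a * b) % N) →
             MultiplicativeAt a b
  mult-via {a} {b} {j} 1≤j jab≢0 j·b a·[jb] j·[ab] c≢0 =
    square≡1⇒*-cancelˡ (f j) (f-square 1≤j) (begin
    f j ℤ.* f c                 ≡⟨ j·[ab] (jab≢0 ∘ trans (sym j·c≡jab)) ⟨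
    f ((j * c) % N)             ≡⟨ cong f (trans j·c≡jab (sym a·[jb]≡jab)) ⟩
    f ((a * ((j * b) % N)) % N) ≡⟨ a·[jb] (jab≢0 ∘ trans (sym a·[jb]≡jab)) ⟩
    f a ℤ.* f ((j * b) % N)     ≡⟨ cong (f a ℤ.*_) (j·b jb≢0) ⟩
    f a ℤ.* (f j ℤ.* f b)       ≡⟨ x∙yz≈y∙xz (f a) (f j) (f b) ⟩
    f j ℤ.* (f a ℤ.* f b)       ∎)
    where
    open ≡-Reasoning
    c : ℕ
    c = (a * b) % N
    j·c≡jab : (j * c) % N ≡ (j * (a * b)) % N
    j·c≡jab = m*[n%d]%d≡m*n%d j (a * b) N
    a·[jb]≡jab : (a * ((j * b) % N)) % N ≡ (j * (a * b)) % N
    a·[jb]≡jab = trans (m*[n%d]%d≡m*n%d a (j * b) N) (cong (_% N) (ℕ*.x∙yz≈y∙xz a j b))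
    jb≢0 : (j * b) % N ≢ 0
    jb≢0 = jab≢0 ∘ trans (cong (_% N) (ℕ*.x∙yz≈y∙xz j a b)) ∘ n%d≡0⇒[m*n]%d≡0 a (j * b) N

  module LargeProduct
    {a b} (a<N : a < N) (b<N : b < N)
    (IHa : ∀ {a′ b′} → a′ < a → b′ < N → MultiplicativeAt a′ b′)
    (IHb : ∀ {b′} → b′ < b → MultiplicativeAt a b′)
    (N<ab : N < a * b)
    where

    1<a : 1 < a
    1<a = ℕP.≰⇒> λ a≤1 → ℕP.<⇒≱ (ℕP.<-trans b<N N<ab)
      (ℕP.≤-trans (ℕP.*-monoˡ-≤ b a≤1) (ℕP.≤-reflexive (ℕP.*-identityˡ b)))

    instance
      a-nonTrivial : ℕ.NonTrivial a
      a-nonTrivial = ℕ.n>1⇒nonTrivial 1<a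
      b≢0 : NonZero b
      b≢0 = ℕ.≢-nonZero λ { refl → ℕP.n≮0 (subst (N <_) (ℕP.*-zeroʳ a) N<ab) }

    mult-composite : Composite a → MultiplicativeAt a b
    mult-composite (composite {d} d<a (divides e a≡e*d)) =
      subst (λ x → MultiplicativeAt x b) (sym a≡e*d)
        (mult-*ˡ (IHa d<a b<N) (IHa e<a (m%n<n (d * b) N)))
      where
      e≢0 : NonZero e
      e≢0 = ℕP.m*n≢0⇒m≢0 e {{subst NonZero a≡e*d (ℕ.>-nonZero (ℕP.<-trans ℕP.0<1+n 1<a))}}
      e<a : e < a
      e<a = subst (e <_) (sym a≡e*d) (ℕP.m<m*n e d {{e≢0}} (ℕ.nonTrivial⇒n>1 d))

    -- p ∣ b since b ∣ p^k and b ≠ 1, and p < a since a ≤ p would give a·b ≤ p·b ≤ N.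
    mult-∣N : b ∣ N → MultiplicativeAt a b
    mult-∣N b∣N = subst (MultiplicativeAt a) (sym b≡p*v)
      (mult-comm (mult-*ˡ (mult-comm (IHb v<b)) (IHa p<a (m%n<n (v * a) N))))
      where
      p∣b : p ∣ b
      p∣b = ∣p^k∧≢1⇒p∣ p-prime k b∣N
        λ { refl → ℕP.<-asym a<N (subst (N <_) (ℕP.*-identityʳ a) N<ab) }
      v : ℕ
      v = quotient p∣b
      b≡p*v : b ≡ p * v
      b≡p*v = m∣n⇒n≡m*quotient p∣b
      v<b : v < b
      v<b = subst (v <_) (trans (ℕP.*-comm v p) (sym b≡p*v))
        (ℕP.m<m*n v p {{ℕP.m*n≢0⇒n≢0 p {{subst NonZero b≡p*v b≢0}}}}
                      (ℕ.nonTrivial⇒n>1 p {{prime⇒nonTrivial p-prime}}))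
      p<a : p < a
      p<a = ℕP.≰⇒> λ a≤p → ℕP.<⇒≱ N<ab
        (ℕP.≤-trans (ℕP.*-monoˡ-≤ b a≤p) (d∣p^k∧d<p^k⇒p*d≤p^k p-prime k b∣N b<N))

    -- With N = q·b + r, multiplying by q turns b into N − r, which reflection relates to r < b;
    -- q < a because q·b < N < a·b.
    mult-prime-∤N : Prime a → ¬ b ∣ N → MultiplicativeAt a b
    mult-prime-∤N a-prime b∤N c≢0 =
      mult-via (ℕP.n≢0⇒n>0 q≢0) qab≢0 (mult-direct qb<N) a·[qb] (IHa q<a (m%n<n (a * b) N)) c≢0
      where
      r q : ℕ
      r = N % b
      q = N / b
      r≢0 : r ≢ 0
      r≢0 = b∤N ∘ m%n≡0⇒n∣m N b
      r<b : r < b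
      r<b = m%n<n N b
      r<N : r < N
      r<N = ℕP.<-trans r<b b<N
      N≡r+qb : N ≡ r + q * b
      N≡r+qb = m≡m%n+[m/n]*n N b
      qb<N : q * b < N
      qb<N = subst (q * b <_) (sym N≡r+qb) (ℕP.m<n+m (q * b) (ℕP.n≢0⇒n>0 r≢0))
      q<a : q < a
      q<a = ℕP.*-cancelʳ-< b q a (ℕP.<-trans qb<N N<ab)
      q≢0 : q ≢ 0
      q≢0 q≡0 = ℕP.<-irrefl (sym (trans N≡r+qb (trans (cong (λ x → r + x * b) q≡0) (ℕP.+-identityʳ r))))
                            r<N
      a·[qb] : MultiplicativeAt a ((q * b) % N)
      a·[qb] = subst (MultiplicativeAt a) (sym (m<n⇒m%n≡m qb<N))
        (mult-reflect qb<N (subst (MultiplicativeAt a) (sym N∸qb≡r) (IHb r<b)))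
        where
        N∸qb≡r : N ∸ q * b ≡ r
        N∸qb≡r = trans (cong (_∸ q * b) N≡r+qb) (ℕP.m+n∸n≡m r (q * b))
      -- If N ∣ q·a·b then p ∣ q (as N ∤ a·b), so p < a, hence p ∤ a and N ∣ q·b < N.
      qab≢0 : (q * (a * b)) % N ≢ 0
      qab≢0 qab≡0 with p ∣? q
      ... | no  p∤q = c≢0 (n∣m⇒m%n≡0 _ N (p^k∣m*n⇒p^k∣n p-prime p∤q k (m%n≡0⇒n∣m _ N qab≡0)))
      ... | yes p∣q =
        ℕP.<⇒≱ qb<N (∣⇒≤ {{ℕP.m*n≢0 q b {{ℕ.≢-nonZero q≢0}}}} (p^k∣m*n⇒p^k∣n p-prime p∤a k N∣a·qb))
        where
        N∣a·qb : N ∣ a * (q * b)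
        N∣a·qb = subst (N ∣_) (ℕ*.x∙yz≈y∙xz q a b) (m%n≡0⇒n∣m _ N qab≡0)
        p∤a : ¬ p ∣ a
        p∤a p∣a with prime⇒irreducible a-prime p∣a
        ... | inj₁ refl = ¬prime[1] p-prime
        ... | inj₂ refl = ℕP.<⇒≱ q<a (∣⇒≤ {{ℕ.≢-nonZero q≢0}} p∣q)

    mult-large : MultiplicativeAt a b
    mult-large with b ∣? N | composite? a
    ... | yes b∣N | _               = mult-∣N b∣N
    ... | no  b∤N | yes a-composite = mult-composite a-composite
    ... | no  b∤N | no  ¬composite  = mult-prime-∤N (prime ¬composite) b∤N

  multiplicativeAt : ∀ a → a < N → ∀ b → b < N → MultiplicativeAt a b
  multiplicativeAt = <-rec _ λ a IHa a<N → <-rec _ λ b IHb b<N c≢0 →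
    case a * b ℕ.<? N of λ where
      (yes ab<N) → mult-direct ab<N c≢0
      (no  ab≮N) → LargeProduct.mult-large a<N b<N
        (λ a′<a b′<N → IHa a′<a (ℕP.<-trans a′<a a<N) _ b′<N)
        (λ b′<b → IHb b′<b (ℕP.<-trans b′<b b<N))
        (ℕP.≤∧≢⇒< (ℕP.≮⇒≥ ab≮N) λ N≡ab → c≢0 (trans (cong (_% N) (sym N≡ab)) (n%n≡0 N)))
        c≢0

infix 4 _≡_mod_
_≡_mod_ : ℤ → ℤ → ℕ → Set
x ≡ y mod d = ∃ λ s → x ≡ y ℤ.+ s ℤ.* + d

≡mod-sym : ∀ {x y d} → x ≡ y mod d → y ≡ x mod d
≡mod-sym {x} {y} {d} (s , x≡y+sd) = - s , (begin
  y                               ≡⟨ cancel y s (+ d) ⟩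
  y ℤ.+ s ℤ.* + d ℤ.+ - s ℤ.* + d ≡⟨ cong (λ z → z ℤ.+ - s ℤ.* + d) x≡y+sd ⟨
  x ℤ.+ - s ℤ.* + d               ∎)
  where
  open ≡-Reasoning
  cancel : ∀ y s d → y ≡ y ℤ.+ s ℤ.* d ℤ.+ - s ℤ.* d
  cancel = solve-∀

%≡%⇒≡mod : ∀ d .{{_ : NonZero d}} x y → x % d ≡ y % d → + x ≡ + y mod d
%≡%⇒≡mod d x y x%d≡y%d = + (x / d) ℤ.- + (y / d) , (begin
  + x                                       ≡⟨ split x ⟩
  + (x % d) ℤ.+ + (x / d) ℤ.* + d           ≡⟨ cong (λ r → + r ℤ.+ + (x / d) ℤ.* + d) x%d≡y%d ⟩
  + (y % d) ℤ.+ + (x / d) ℤ.* + d           ≡⟨ regroup (+ (y % d)) (+ (x / d)) (+ (y / d)) (+ d) ⟩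
  + (y % d) ℤ.+ + (y / d) ℤ.* + d ℤ.+ (+ (x / d) ℤ.- + (y / d)) ℤ.* + d
                                            ≡⟨ cong (ℤ._+ (+ (x / d) ℤ.- + (y / d)) ℤ.* + d) (split y) ⟨
  + y ℤ.+ (+ (x / d) ℤ.- + (y / d)) ℤ.* + d ∎)
  where
  open ≡-Reasoning
  regroup : ∀ r a b d → r ℤ.+ a ℤ.* d ≡ r ℤ.+ b ℤ.* d ℤ.+ (a ℤ.- b) ℤ.* d
  regroup = solve-∀
  split : ∀ z → + z ≡ + (z % d) ℤ.+ + (z / d) ℤ.* + d
  split z = trans (cong +_ (m≡m%n+[m/n]*n z d)) (trans (ℤP.pos-+ (z % d) (z / d * d))
                                                       (cong (ℤ._+_ (+ (z % d))) (ℤP.pos-* (z / d) d)))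

≡mod⇒%≡% : ∀ d .{{_ : NonZero d}} x y → + x ≡ + y mod d → x % d ≡ y % d
≡mod⇒%≡% d x y = from-sign
  where
  nonnegative : ∀ {x y} t → + x ≡ + y ℤ.+ + t ℤ.* + d → x % d ≡ y % d
  nonnegative {x} {y} t x≡y+td = trans (cong (_% d) (ℤP.+-injective (trans x≡y+td
    (trans (cong (ℤ._+_ (+ y)) (sym (ℤP.pos-* t d))) (sym (ℤP.pos-+ y (t * d)))))))
    ([m+kn]%n≡m%n y t d)
  from-sign : ∀ {x y} → + x ≡ + y mod d → x % d ≡ y % d
  from-sign (+ t , x≡y+td)        = nonnegative t x≡y+td
  from-sign x≡y@(-[1+ t ] , _)    = sym (nonnegative (suc t) (proj₂ (≡mod-sym x≡y)))

≡mod-∣ : ∀ {x y} d e → x ≡ y mod (d * e) → x ≡ y mod d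
≡mod-∣ {x} {y} d e (s , x≡y+s[de]) = s ℤ.* + e , (begin
  x                         ≡⟨ x≡y+s[de] ⟩
  y ℤ.+ s ℤ.* + (d * e)     ≡⟨ cong (λ z → y ℤ.+ s ℤ.* z) (ℤP.pos-* d e) ⟩
  y ℤ.+ s ℤ.* (+ d ℤ.* + e) ≡⟨ cong (ℤ._+_ y) (x∙yz≈xz∙y s (+ d) (+ e)) ⟩
  y ℤ.+ s ℤ.* + e ℤ.* + d   ∎)
  where open ≡-Reasoning

+[∣i∣*∣i∣]≡i*i : ∀ i → + (∣ i ∣ * ∣ i ∣) ≡ i ℤ.* i
+[∣i∣*∣i∣]≡i*i (+ n)    = ℤP.pos-* n n
+[∣i∣*∣i∣]≡i*i -[1+ n ] = refl

-- Hensel's correction of a square root Y of M modulo P·Q, with U an inverse of 2Y modulo P.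
newton-step : ∀ Y M s U w P Q →
  Y ℤ.* Y ≡ M ℤ.+ s ℤ.* (P ℤ.* Q) → + 2 ℤ.* Y ℤ.* U ≡ 1ℤ ℤ.+ w ℤ.* P →
  let Y′ = Y ℤ.- s ℤ.* U ℤ.* (P ℤ.* Q) in
  Y′ ℤ.* Y′ ≡ M ℤ.+ (s ℤ.* s ℤ.* U ℤ.* U ℤ.* Q ℤ.- s ℤ.* w) ℤ.* (P ℤ.* (P ℤ.* Q))
newton-step Y M s U w P Q Y²≡M+sPQ 2YU≡1+wP = begin
  (Y ℤ.- s ℤ.* U ℤ.* (P ℤ.* Q)) ℤ.* (Y ℤ.- s ℤ.* U ℤ.* (P ℤ.* Q))
    ≡⟨ expand Y M s U w P Q ⟩
  M ℤ.+ c′ ℤ.* (P ℤ.* (P ℤ.* Q)) ℤ.+ s ℤ.* (P ℤ.* Q) ℤ.* (1ℤ ℤ.+ w ℤ.* P ℤ.- + 2 ℤ.* Y ℤ.* U)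
    ℤ.+ (Y ℤ.* Y ℤ.- (M ℤ.+ s ℤ.* (P ℤ.* Q)))
    ≡⟨ cong₂ (λ a b → M ℤ.+ c′ ℤ.* (P ℤ.* (P ℤ.* Q)) ℤ.+ s ℤ.* (P ℤ.* Q) ℤ.* a ℤ.+ b)
             (trans (cong (ℤ._- + 2 ℤ.* Y ℤ.* U) (sym 2YU≡1+wP)) (ℤP.+-inverseʳ (+ 2 ℤ.* Y ℤ.* U)))
             (trans (cong (ℤ._- (M ℤ.+ s ℤ.* (P ℤ.* Q))) Y²≡M+sPQ)
                    (ℤP.+-inverseʳ (M ℤ.+ s ℤ.* (P ℤ.* Q)))) ⟩
  M ℤ.+ c′ ℤ.* (P ℤ.* (P ℤ.* Q)) ℤ.+ s ℤ.* (P ℤ.* Q) ℤ.* + 0 ℤ.+ + 0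
    ≡⟨ drop-zeros (M ℤ.+ c′ ℤ.* (P ℤ.* (P ℤ.* Q))) (s ℤ.* (P ℤ.* Q)) ⟩
  M ℤ.+ c′ ℤ.* (P ℤ.* (P ℤ.* Q)) ∎
  where
  open ≡-Reasoning
  c′ : ℤ
  c′ = s ℤ.* s ℤ.* U ℤ.* U ℤ.* Q ℤ.- s ℤ.* w
  expand : ∀ Y M s U w P Q →
    (Y ℤ.- s ℤ.* U ℤ.* (P ℤ.* Q)) ℤ.* (Y ℤ.- s ℤ.* U ℤ.* (P ℤ.* Q))
    ≡ M ℤ.+ (s ℤ.* s ℤ.* U ℤ.* U ℤ.* Q ℤ.- s ℤ.* w) ℤ.* (P ℤ.* (P ℤ.* Q))
      ℤ.+ s ℤ.* (P ℤ.* Q) ℤ.* (1ℤ ℤ.+ w ℤ.* P ℤ.- + 2 ℤ.* Y ℤ.* U)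
      ℤ.+ (Y ℤ.* Y ℤ.- (M ℤ.+ s ℤ.* (P ℤ.* Q)))
  expand = solve-∀
  drop-zeros : ∀ a b → a ℤ.+ b ℤ.* + 0 ℤ.+ + 0 ≡ a
  drop-zeros = solve-∀

[m+n]%d≡m%d⇒d∣n : ∀ m n d .{{_ : NonZero d}} → (m + n) % d ≡ m % d → d ∣ n
[m+n]%d≡m%d⇒d∣n m n d [m+n]%d≡m%d with %≡%⇒≡mod d (m + n) m [m+n]%d≡m%d
... | s , m+n≡m+sd =
  m%n≡0⇒n∣m n d (trans (≡mod⇒%≡% d n 0 (s , n≡0+sd)) (m<n⇒m%n≡m (ℕ.>-nonZero⁻¹ d)))
  where
  open ≡-Reasoning
  cancel : ∀ a b → a ℤ.+ b ℤ.- a ≡ + 0 ℤ.+ b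
  cancel = solve-∀
  n≡0+sd : + n ≡ + 0 ℤ.+ s ℤ.* + d
  n≡0+sd = begin
    + n                       ≡⟨ cancel (+ m) (+ n) ⟨
    + m ℤ.+ + n ℤ.- + m       ≡⟨ cong (ℤ._- + m) (ℤP.pos-+ m n) ⟨
    + (m + n) ℤ.- + m         ≡⟨ cong (ℤ._- + m) m+n≡m+sd ⟩
    + m ℤ.+ s ℤ.* + d ℤ.- + m ≡⟨ cancel (+ m) (s ℤ.* + d) ⟩
    + 0 ℤ.+ s ℤ.* + d         ∎

injectiveOn⇒surjectiveOn : ∀ n (g : ℕ → ℕ) → (∀ {i} → i < n → g i < n) →
  (∀ {i j} → i < n → j < n → g i ≡ g j → i ≡ j) → ∀ {y} → y < n → ∃ λ i → i < n × g i ≡ y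
injectiveOn⇒surjectiveOn (suc n) g g< g-injective {y} y<n
  with FinP.any? (λ (i : Fin (suc n)) → g (toℕ i) ℕ.≟ y)
... | yes (i , gi≡y) = toℕ i , FinP.toℕ<n i , gi≡y
... | no  y∉image    = contradiction (FinP.injective⇒≤ G-injective) ℕP.1+n≰n
  where
  G′ : Fin (suc n) → Fin (suc n)
  G′ i = fromℕ< (g< (FinP.toℕ<n i))
  y≢G′ : ∀ i → fromℕ< y<n ≢ G′ i
  y≢G′ i y≡G′i = y∉image (i , trans (sym (FinP.toℕ-fromℕ< (g< (FinP.toℕ<n i))))
                               (trans (cong toℕ (sym y≡G′i)) (FinP.toℕ-fromℕ< y<n)))
  G : Fin (suc n) → Fin n
  G i = punchOut (y≢G′ i)
  G-injective : ∀ {i j} → G i ≡ G j → i ≡ j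
  G-injective {i} {j} Gi≡Gj =
    FinP.toℕ-injective (g-injective (FinP.toℕ<n i) (FinP.toℕ<n j) (begin
      g (toℕ i)  ≡⟨ FinP.toℕ-fromℕ< (g< (FinP.toℕ<n i)) ⟨
      toℕ (G′ i) ≡⟨ cong toℕ (FinP.punchOut-injective (y≢G′ i) (y≢G′ j) Gi≡Gj) ⟩
      toℕ (G′ j) ≡⟨ FinP.toℕ-fromℕ< (g< (FinP.toℕ<n j)) ⟩
      g (toℕ j)  ∎))
    where open ≡-Reasoning

QuadraticResidue : (p : ℕ) .{{_ : NonZero p}} → ℕ → Set
QuadraticResidue p m = ∃ λ x → (x * x) % p ≡ m % p

module _ (p : ℕ) .{{_ : NonZero p}} (m : ℕ) where

  private
    SquareRootBelow : Set
    SquareRootBelow = Any.Any (λ x → (x * x) % p ≡ m % p) (upTo p)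

    residue⇒rootBelow : QuadraticResidue p m → SquareRootBelow
    residue⇒rootBelow (x , x²≡m) =
      lose (∈-upTo⁺ (m%n<n x p)) (trans (sym (%-distribˡ-* x x p)) x²≡m)

  quadraticResidue? : Dec (QuadraticResidue p m)
  quadraticResidue? = Dec.map′ Any.satisfied residue⇒rootBelow
    (any? (λ x → ((x * x) % p) ℕ.≟ (m % p)) (upTo p))

  legendre-residue : ¬ p ∣ m → QuadraticResidue p m → legendre p m ≡ 1ℤ
  legendre-residue p∤m residue with p ∣? m
  ... | yes p∣m = contradiction p∣m p∤m
  ... | no  _ with any? (λ x → ((x * x) % p) ℕ.≟ (m % p)) (upTo p)
  ...   | yes _        = refl
  ...   | no  no-root = contradiction (residue⇒rootBelow residue) no-root

  legendre-nonresidue : ¬ p ∣ m → ¬ QuadraticResidue p m → legendre p m ≡ -1ℤ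
  legendre-nonresidue p∤m nonresidue with p ∣? m
  ... | yes p∣m = contradiction p∣m p∤m
  ... | no  _ with any? (λ x → ((x * x) % p) ℕ.≟ (m % p)) (upTo p)
  ...   | yes root = contradiction (Any.satisfied root) nonresidue
  ...   | no  _    = refl

module PrimeModulus {p : ℕ} (p-prime : Prime p) where

  instance
    p≢0 : NonZero p
    p≢0 = prime⇒nonZero p-prime

  p^≢0 : ∀ k → NonZero (p ^ k)
  p^≢0 k = ℕP.m^n≢0 p k

  1<p : 1 < p
  1<p = ℕ.nonTrivial⇒n>1 p {{prime⇒nonTrivial p-prime}}

  ∣∧<⇒≡0 : ∀ {n} → p ∣ n → n < p → n ≡ 0
  ∣∧<⇒≡0 {zero}  _   _   = refl
  ∣∧<⇒≡0 {suc n} p∣n n<p = contradiction p∣n (>⇒∤ n<p)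

  p∤⇒coprime : ∀ {b} → ¬ p ∣ b → Coprime b p
  p∤⇒coprime p∤b (i∣b , i∣p) with prime⇒irreducible p-prime i∣p
  ... | inj₁ i≡1  = i≡1
  ... | inj₂ refl = contradiction i∣b p∤b

  inverse : ∀ {b} → ¬ p ∣ b → ∃ λ u → (b * u) % p ≡ 1
  inverse {b} p∤b with coprime-Bézout (p∤⇒coprime p∤b)
  ... | Bézout.+- x y 1+yp≡xb = x , (begin
    (b * x) % p     ≡⟨ cong (_% p) (trans (ℕP.*-comm b x) (sym 1+yp≡xb)) ⟩
    (1 + y * p) % p ≡⟨ [m+kn]%n≡m%n 1 y p ⟩
    1 % p           ≡⟨ m<n⇒m%n≡m 1<p ⟩
    1               ∎)
    where open ≡-Reasoning
  ... | Bézout.-+ x y 1+xb≡yp = (p ∸ 1) * x , (begin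
    (b * ((p ∸ 1) * x)) % p       ≡⟨ cong (_% p) (ℕ*.x∙yz≈y∙zx b (p ∸ 1) x) ⟩
    ((p ∸ 1) * (x * b)) % p       ≡⟨ m*[n%d]%d≡m*n%d (p ∸ 1) (x * b) p ⟨
    ((p ∸ 1) * ((x * b) % p)) % p ≡⟨ cong (λ r → ((p ∸ 1) * r) % p) xb%p≡p∸1 ⟩
    ((p ∸ 1) * (p ∸ 1)) % p       ≡⟨ [n∸1]*[n∸1]%n≡1 p 1<p ⟩
    1                             ∎)
    where
    open ≡-Reasoning
    xb%p≡p∸1 : (x * b) % p ≡ p ∸ 1
    xb%p≡p∸1 = %-pred-≡0 (trans (cong (_% p) 1+xb≡yp) (m*n%n≡0 y p))

  *square%-injective : ∀ {c x y} → ¬ p ∣ c → x + y < p →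
                       (c * (x * x)) % p ≡ (c * (y * y)) % p → x ≡ y
  *square%-injective {c} {x} {y} p∤c x+y<p cx²≡cy² =
    [ ordered x+y<p cx²≡cy²
    , (λ y≤x → sym (ordered (subst (_< p) (ℕP.+-comm x y) x+y<p) (sym cx²≡cy²) y≤x))
    ]′ (ℕP.≤-total x y)
    where
    -- With y = x + d, c y² = c x² + c d (x + y), so p divides d or x + y; both are below p.
    ordered : ∀ {x y} → x + y < p → (c * (x * x)) % p ≡ (c * (y * y)) % p → x ≤ y → x ≡ y
    ordered {x} {y} x+y<p cx²≡cy² x≤y =
      [ (λ p∣d   → d≡0⇒x≡y (∣∧<⇒≡0 p∣d d<p))
      , (λ p∣x+y → x+y≡0⇒x≡y (∣∧<⇒≡0 p∣x+y x+y<p))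
      ]′ (euclidsLemma d (x + y) p-prime p∣d·[x+y])
      where
      open ≡-Reasoning
      d : ℕ
      d = y ∸ x
      y≡x+d : y ≡ x + d
      y≡x+d = sym (ℕP.m+[n∸m]≡n x≤y)
      d<p : d < p
      d<p = ℕP.≤-<-trans (ℕP.m∸n≤m y x) (ℕP.≤-<-trans (ℕP.m≤n+m y x) x+y<p)
      expand : ∀ c x d → c * ((x + d) * (x + d)) ≡ c * (x * x) + c * (d * (x + (x + d)))
      expand = ℕ-Ring.solve-∀
      p∣c·d·[x+y] : p ∣ c * (d * (x + y))
      p∣c·d·[x+y] = [m+n]%d≡m%d⇒d∣n (c * (x * x)) _ p (begin
        (c * (x * x) + c * (d * (x + y))) % p
          ≡⟨ cong (λ z → (c * (x * x) + c * (d * (x + z))) % p) y≡x+d ⟩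
        (c * (x * x) + c * (d * (x + (x + d)))) % p ≡⟨ cong (_% p) (expand c x d) ⟨
        (c * ((x + d) * (x + d))) % p               ≡⟨ cong (λ z → (c * (z * z)) % p) y≡x+d ⟨
        (c * (y * y)) % p                           ≡⟨ cx²≡cy² ⟨
        (c * (x * x)) % p                           ∎)
      p∣d·[x+y] : p ∣ d * (x + y)
      p∣d·[x+y] = [ flip contradiction p∤c , id ]′
                    (euclidsLemma c (d * (x + y)) p-prime p∣c·d·[x+y])
      d≡0⇒x≡y : d ≡ 0 → x ≡ y
      d≡0⇒x≡y d≡0 = sym (trans y≡x+d (trans (cong (_+_ x) d≡0) (ℕP.+-identityʳ x)))
      x+y≡0⇒x≡y : x + y ≡ 0 → x ≡ y
      x+y≡0⇒x≡y x+y≡0 = trans (ℕP.m+n≡0⇒m≡0 x x+y≡0) (sym (ℕP.m+n≡0⇒n≡0 x x+y≡0))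

  square≡2*square⇒residue[2] : ∀ {x y} → ¬ p ∣ y → (x * x) % p ≡ (2 * (y * y)) % p →
                               QuadraticResidue p 2
  square≡2*square⇒residue[2] {x} {y} p∤y x²≡2y² = x * u , (begin
    ((x * u) * (x * u)) % p             ≡⟨ cong (_% p) (ℕ*.interchange x u x u) ⟩
    ((x * x) * (u * u)) % p             ≡⟨ [m%d]*n%d≡m*n%d (x * x) (u * u) p ⟨
    (((x * x) % p) * (u * u)) % p       ≡⟨ cong (λ z → (z * (u * u)) % p) x²≡2y² ⟩
    (((2 * (y * y)) % p) * (u * u)) % p ≡⟨ [m%d]*n%d≡m*n%d (2 * (y * y)) (u * u) p ⟩
    ((2 * (y * y)) * (u * u)) % p       ≡⟨ cong (_% p) (regroup y u) ⟩
    (2 * ((y * u) * (y * u))) % p       ≡⟨ m*[n%d]%d≡m*n%d 2 ((y * u) * (y * u)) p ⟨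
    (2 * (((y * u) * (y * u)) % p)) % p ≡⟨ cong (λ z → (2 * z) % p) [yu]²≡1 ⟩
    2 % p                               ∎)
    where
    open ≡-Reasoning
    u : ℕ
    u = proj₁ (inverse p∤y)
    [yu]²≡1 : ((y * u) * (y * u)) % p ≡ 1
    [yu]²≡1 = trans (%-distribˡ-* (y * u) (y * u) p)
      (trans (cong₂ (λ a b → (a * b) % p) (proj₂ (inverse p∤y)) (proj₂ (inverse p∤y))) (m<n⇒m%n≡m 1<p))
    regroup : ∀ y u → (2 * (y * y)) * (u * u) ≡ 2 * ((y * u) * (y * u))
    regroup = ℕ-Ring.solve-∀

  module OddPrimeModulus (p-odd : ¬ 2 ∣ p) where

    h : ℕ
    h = p / 2

    p≡1+2h : p ≡ suc (h + h)
    p≡1+2h with p % 2 | m%n<n p 2 | m≡m%n+[m/n]*n p 2 | p-odd ∘ m%n≡0⇒n∣m p 2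
    ... | zero        | _            | _           | p%2≢0 = contradiction refl p%2≢0
    ... | suc zero    | _            | p≡1+[p/2]*2 | _     = trans p≡1+[p/2]*2 (cong suc (double h))
      where
      double : ∀ h → h * 2 ≡ h + h
      double = ℕ-Ring.solve-∀
    ... | suc (suc _) | s≤s (s≤s ()) | _           | _

    p∤2 : ¬ p ∣ 2
    p∤2 p∣2 = p-odd (subst (_∣ p) (ℕP.≤-antisym (∣⇒≤ p∣2) 1<p) (∣-refl {p}))

    ∸h≤h : ∀ {i} → i < p → i ∸ h ≤ h
    ∸h≤h {i} i<p = ℕP.m≤n+o⇒m∸n≤o i h (ℕP.≤-pred (subst (i <_) p≡1+2h i<p))

    halves< : ∀ {x y} → x ≤ h → y ≤ h → x + y < p
    halves< x≤h y≤h = subst (_ <_) (sym p≡1+2h) (s≤s (ℕP.+-mono-≤ x≤h y≤h))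

    p∤∸h : ∀ {i} → ¬ i ≤ h → i < p → ¬ p ∣ (i ∸ h)
    p∤∸h {i} i≰h i<p = >⇒∤ {{ℕ.>-nonZero (ℕP.m<n⇒0<n∸m (ℕP.≰⇒> i≰h))}}
      (ℕP.≤-<-trans (∸h≤h i<p) (ℕP.≤-<-trans (ℕP.m≤m+n h h) (subst (h + h <_) (sym p≡1+2h) ℕP.≤-refl)))

    %1* : ∀ n → (1 * n) % p ≡ n % p
    %1* n = cong (_% p) (ℕP.*-identityˡ n)

    -- On [0, p), residue i is i² for i ≤ h and 2 (i − h)² for i > h. When 2 is a non-residue it
    -- is injective, hence onto: every residue is a square or twice a square.
    coefficient : ℕ → ℕ
    coefficient i with i ℕ.≤? h
    ... | yes _ = 1
    ... | no  _ = 2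

    root : ℕ → ℕ
    root i with i ℕ.≤? h
    ... | yes _ = i
    ... | no  _ = i ∸ h

    residue : ℕ → ℕ
    residue i = (coefficient i * (root i * root i)) % p

    module _ (2-nonresidue : ¬ QuadraticResidue p 2) where

      residue-injective : ∀ {i j} → i < p → j < p → residue i ≡ residue j → i ≡ j
      residue-injective {i} {j} i<p j<p eq with i ℕ.≤? h | j ℕ.≤? h
      ... | yes i≤h | yes j≤h = *square%-injective (>⇒∤ 1<p) (halves< i≤h j≤h) eq
      ... | no  i≰h | no  j≰h = ℕP.∸-cancelʳ-≡ (ℕP.≰⇒≥ i≰h) (ℕP.≰⇒≥ j≰h)
        (*square%-injective p∤2 (halves< (∸h≤h i<p) (∸h≤h j<p)) eq)
      ... | yes _   | no  j≰h = contradiction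
        (square≡2*square⇒residue[2] {x = i} (p∤∸h j≰h j<p) (trans (sym (%1* (i * i))) eq))
        2-nonresidue
      ... | no  i≰h | yes _   = contradiction
        (square≡2*square⇒residue[2] {x = j} (p∤∸h i≰h i<p) (trans (sym (%1* (j * j))) (sym eq)))
        2-nonresidue

      covering : ∀ m → QuadraticResidue p m ⊎ ∃ λ x → (2 * (x * x)) % p ≡ m % p
      covering m
        with injectiveOn⇒surjectiveOn p residue (λ _ → m%n<n _ p) residue-injective (m%n<n m p)
      ... | i , _ , residue[i]≡m with i ℕ.≤? h
      ...   | yes _ = inj₁ (i , trans (sym (%1* (i * i))) residue[i]≡m)
      ...   | no  _ = inj₂ (i ∸ h , residue[i]≡m)

      residue-2* : ∀ {m} → ¬ QuadraticResidue p m → QuadraticResidue p (2 * m)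
      residue-2* {m} m-nonresidue with covering m
      ... | inj₁ m-residue    = contradiction m-residue m-nonresidue
      ... | inj₂ (x , 2x²≡m) = 2 * x , (begin
        ((2 * x) * (2 * x)) % p       ≡⟨ cong (_% p) (regroup x) ⟩
        (2 * (2 * (x * x))) % p       ≡⟨ m*[n%d]%d≡m*n%d 2 (2 * (x * x)) p ⟨
        (2 * ((2 * (x * x)) % p)) % p ≡⟨ cong (λ z → (2 * z) % p) 2x²≡m ⟩
        (2 * (m % p)) % p             ≡⟨ m*[n%d]%d≡m*n%d 2 m p ⟩
        (2 * m) % p                   ∎)
        where
        open ≡-Reasoning
        regroup : ∀ x → (2 * x) * (2 * x) ≡ 2 * (2 * (x * x))
        regroup = ℕ-Ring.solve-∀

    lift-root : ∀ {m y} i → ¬ p ∣ m → + (y * y) ≡ + m mod p ^ suc i →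
                ∃ λ y′ → + (y′ * y′) ≡ + m mod p ^ suc (suc i)
    lift-root {m} {y} i p∤m y²≡m@(s , y²≡m+s·p^[1+i]) = ∣ Y′ ∣ , c′ , (begin
      + (∣ Y′ ∣ * ∣ Y′ ∣)                          ≡⟨ +[∣i∣*∣i∣]≡i*i Y′ ⟩
      Y′ ℤ.* Y′                                    ≡⟨ newton-step (+ y) (+ m) s (+ u) w (+ p) (+ (p ^ i))
                                                                    Y²≡M+sPQ 2YU≡1+wP ⟩
      + m ℤ.+ c′ ℤ.* (+ p ℤ.* (+ p ℤ.* + (p ^ i))) ≡⟨ cong (λ z → + m ℤ.+ c′ ℤ.* z) p·p·p^i ⟨
      + m ℤ.+ c′ ℤ.* + (p ^ suc (suc i))           ∎)
      where
      open ≡-Reasoning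
      p·p^i : + (p ^ suc i) ≡ + p ℤ.* + (p ^ i)
      p·p^i = ℤP.pos-* p (p ^ i)
      p·p·p^i : + (p ^ suc (suc i)) ≡ + p ℤ.* (+ p ℤ.* + (p ^ i))
      p·p·p^i = trans (ℤP.pos-* p (p ^ suc i)) (cong (+ p ℤ.*_) p·p^i)
      Y²≡M+sPQ : + y ℤ.* + y ≡ + m ℤ.+ s ℤ.* (+ p ℤ.* + (p ^ i))
      Y²≡M+sPQ = trans (sym (ℤP.pos-* y y))
                       (trans y²≡m+s·p^[1+i] (cong (λ z → + m ℤ.+ s ℤ.* z) p·p^i))
      y²%p≡m%p : (y * y) % p ≡ m % p
      y²%p≡m%p = ≡mod⇒%≡% p (y * y) m (≡mod-∣ {+ (y * y)} {+ m} p (p ^ i) y²≡m)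
      p∤y : ¬ p ∣ y
      p∤y p∣y = p∤m (m%n≡0⇒n∣m m p (trans (sym y²%p≡m%p) (n∣m⇒m%n≡0 (y * y) p (∣m⇒∣m*n y p∣y))))
      p∤2y : ¬ p ∣ 2 * y
      p∤2y = [ p∤2 , p∤y ]′ ∘ euclidsLemma 2 y p-prime
      u : ℕ
      u = proj₁ (inverse p∤2y)
      2yu≡1 : + (2 * y * u) ≡ + 1 mod p
      2yu≡1 = %≡%⇒≡mod p (2 * y * u) 1 (trans (proj₂ (inverse p∤2y)) (sym (m<n⇒m%n≡m 1<p)))
      w : ℤ
      w = proj₁ 2yu≡1
      2YU≡1+wP : + 2 ℤ.* + y ℤ.* + u ≡ 1ℤ ℤ.+ w ℤ.* + p
      2YU≡1+wP = trans (sym (trans (ℤP.pos-* (2 * y) u) (cong (ℤ._* + u) (ℤP.pos-* 2 y))))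
                       (proj₂ 2yu≡1)
      Y′ c′ : ℤ
      Y′ = + y ℤ.- s ℤ.* + u ℤ.* (+ p ℤ.* + (p ^ i))
      c′ = s ℤ.* s ℤ.* + u ℤ.* + u ℤ.* + (p ^ i) ℤ.- s ℤ.* w

    lift-residue : ∀ {m} → ¬ p ∣ m → QuadraticResidue p m →
                   ∀ i → QuadraticResidue (p ^ suc i) {{p^≢0 (suc i)}} m
    lift-residue {m} p∤m (x , x²≡m) i =
      proj₁ (roots i) , ≡mod⇒%≡% _ {{p^≢0 (suc i)}} _ m (proj₂ (roots i))
      where
      roots : ∀ i → ∃ λ y → + (y * y) ≡ + m mod p ^ suc i
      roots zero    = x , subst (λ d → + (x * x) ≡ + m mod d) (sym (ℕP.*-identityʳ p))
                                (%≡%⇒≡mod p (x * x) m x²≡m)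
      roots (suc i) = lift-root {y = proj₁ (roots i)} i p∤m (proj₂ (roots i))

module LiouvilleModPrimePower
  {p : ℕ} (p-prime : Prime p) (p-odd : ¬ 2 ∣ p) (k : ℕ)
  (∣L∣≡N∸1 : ∣ Lλ (p ^ suc k) ∣ ≡ p ^ suc k ∸ 1)
  where

  open PrimeModulus p-prime
  open OddPrimeModulus p-odd

  N : ℕ
  N = p ^ suc k

  instance
    N≢0 : NonZero N
    N≢0 = p^≢0 (suc k)

  reflection : ∃ λ ε → IsSign ε ×
               (∀ {n} → 1 ≤ n → n < N → liouville₀ (N ∸ n) ≡ ε ℤ.* liouville₀ n)
  reflection = liouville-reflection N ∣L∣≡N∸1

  open ModularMultiplicativity p-prime (suc k) liouville₀ liouville₀-*
    (sign-square ∘ liouville₀-sign) (proj₁ reflection) (sign-square (proj₁ (proj₂ reflection)))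
    (proj₂ (proj₂ reflection))
    using (multiplicativeAt)

  p∣N : p ∣ N
  p∣N = m∣m*n (p ^ k)

  p∤⇒p∤%N : ∀ {m} → ¬ p ∣ m → ¬ p ∣ m % N
  p∤⇒p∤%N p∤m = p∤m ∘ ∣n∣m%n⇒∣m p∣N

  residue⇒residue%N : ∀ {m} → QuadraticResidue p m → QuadraticResidue p (m % N)
  residue⇒residue%N {m} (x , x²≡m) = x , trans x²≡m (sym (m∣n⇒o%n%m≡o%m p N m p∣N))

  liouville-square : ∀ y → (y * y) % N ≢ 0 → liouville₀ ((y * y) % N) ≡ 1ℤ
  liouville-square y y²≢0 = begin
    liouville₀ ((y * y) % N)
      ≡⟨ cong liouville₀ (%-distribˡ-* y y N) ⟩
    liouville₀ (((y % N) * (y % N)) % N)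
      ≡⟨ multiplicativeAt (y % N) (m%n<n y N) (y % N) (m%n<n y N) (y²≢0 ∘ trans (%-distribˡ-* y y N)) ⟩
    liouville₀ (y % N) ℤ.* liouville₀ (y % N)
      ≡⟨ sign-square (liouville₀-sign (ℕP.n≢0⇒n>0 y%N≢0)) ⟩
    1ℤ ∎
    where
    open ≡-Reasoning
    y%N≢0 : y % N ≢ 0
    y%N≢0 = y²≢0 ∘ n%d≡0⇒[m*n]%d≡0 y y N

  liouville-residue : ∀ {m} → m < N → ¬ p ∣ m → QuadraticResidue p m → liouville₀ m ≡ 1ℤ
  liouville-residue {m} m<N p∤m m-residue = begin
    liouville₀ m             ≡⟨ cong liouville₀ y²≡m ⟨
    liouville₀ ((y * y) % N) ≡⟨ liouville-square y y²≢0 ⟩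
    1ℤ                       ∎
    where
    open ≡-Reasoning
    y : ℕ
    y = proj₁ (lift-residue p∤m m-residue k)
    y²≡m : (y * y) % N ≡ m
    y²≡m = trans (proj₂ (lift-residue p∤m m-residue k)) (m<n⇒m%n≡m m<N)
    y²≢0 : (y * y) % N ≢ 0
    y²≢0 y²≡0 = p∤m (subst (p ∣_) (trans (sym y²≡0) y²≡m) (p ∣0))

  2<N : 2 < N
  2<N = ℕP.<-≤-trans 2<p (ℕP.m≤m*n p (p ^ k) {{p^≢0 k}})
    where
    2<p : 2 < p
    2<p = ℕP.≤∧≢⇒< 1<p λ 2≡p → p-odd (subst (2 ∣_) 2≡p (∣-refl {2}))

  -- λ(2) = −1 by computation.
  2-nonresidue : ¬ QuadraticResidue p 2
  2-nonresidue 2-residue with liouville-residue 2<N p∤2 2-residue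
  ... | ()

  liouville-nonresidue : ∀ {n} → n < N → ¬ p ∣ n → ¬ QuadraticResidue p n → liouville₀ n ≡ -1ℤ
  liouville-nonresidue {n} n<N p∤n n-nonresidue = begin
    liouville₀ n                      ≡⟨ ℤP.neg-involutive (liouville₀ n) ⟨
    - (- liouville₀ n)                ≡⟨ cong -_ (ℤP.-1*i≡-i (liouville₀ n)) ⟨
    - (liouville₀ 2 ℤ.* liouville₀ n) ≡⟨ cong -_ (multiplicativeAt 2 2<N n n<N [2n]%N≢0) ⟨
    - liouville₀ ((2 * n) % N)        ≡⟨ cong -_ (liouville-residue (m%n<n (2 * n) N) p∤[2n]%N
                                          (residue⇒residue%N (residue-2* 2-nonresidue n-nonresidue))) ⟩
    -1ℤ                               ∎
    where
    open ≡-Reasoning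
    p∤[2n]%N : ¬ p ∣ (2 * n) % N
    p∤[2n]%N = p∤⇒p∤%N ([ p∤2 , p∤n ]′ ∘ euclidsLemma 2 n p-prime)
    [2n]%N≢0 : (2 * n) % N ≢ 0
    [2n]%N≢0 [2n]%N≡0 = p∤[2n]%N (subst (p ∣_) (sym [2n]%N≡0) (p ∣0))

lemma2p9 : (p : ℕ) → .{{_ : NonZero p}} → Prime p → ¬ (2 ∣ p) →
    (k : ℕ) → 1 ≤ k → ∣ Lλ (p ^ k) ∣ ≡ p ^ k ∸ 1 →
    (n : ℕ) → .{{_ : NonZero n}} → n < p ^ k → ¬ (p ∣ n) →
    liouville n ≡ legendre p n
lemma2p9 p p-prime p-odd (suc k) _ ∣L∣≡N∸1 n n<N p∤n =
  trans (liouville≡liouville₀ n) (by-residuosity (quadraticResidue? p n))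
  where
  open LiouvilleModPrimePower p-prime p-odd k ∣L∣≡N∸1
  by-residuosity : Dec (QuadraticResidue p n) → liouville₀ n ≡ legendre p n
  by-residuosity (yes n-residue)    = trans (liouville-residue n<N p∤n n-residue)
                                            (sym (legendre-residue p n p∤n n-residue))
  by-residuosity (no  n-nonresidue) = trans (liouville-nonresidue n<N p∤n n-nonresidue)
                                            (sym (legendre-nonresidue p n p∤n n-nonresidue))
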